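{- Let $A=(A_1,\dots,A_n)$ and $B=(B_1,\dots,B_n)$ be sequences of real numbers with $A_i,B_i\in[0,c]$ for all $i\in[n]$. Then there exists an index $z\in[n]$ such that $\left|\left(\sum_{i=1}^{z}A_i+\sum_{i=z+1}^{n}B_i\right)-\left(\sum_{i=1}^{z}B_i+\sum_{i=z+1}^{n}A_i\right)\right|\le c.$ -}

module Defs where

open import Level using (0ℓ)
open import Data.Nat using (ℕ; zero; suc; _≤ᵇ_)
open import Data.Fin using (Fin; toℕ)
import Data.Fin as F
open import Data.Bool using (if_then_else_)
open import Data.Product using (Σ; ∃; _×_)
open import Relation.Binary.PropositionalEquality using (_≡_; _≢_)
open import Relation.Binary.Structures using (IsTotalOrder)
open import Algebra.Structures using (IsCommutativeRing)

-- The real numbers, axiomatised as a complete ordered field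
-- (any model of these axioms is isomorphic to ℝ).
record RealField : Set₁ where
  infixl 6 _+_ _-_
  infixl 7 _*_
  infix  4 _≤_
  field
    ℝ     : Set
    _+_   : ℝ → ℝ → ℝ
    _*_   : ℝ → ℝ → ℝ
    -_    : ℝ → ℝ
    0ℝ    : ℝ
    1ℝ    : ℝ
    inv   : (x : ℝ) → x ≢ 0ℝ → ℝ
    _≤_   : ℝ → ℝ → Set
    isCommutativeRing : IsCommutativeRing _≡_ _+_ _*_ -_ 0ℝ 1ℝ
    *-inverse  : (x : ℝ) (p : x ≢ 0ℝ) → x * inv x p ≡ 1ℝ
    0≢1        : 0ℝ ≢ 1ℝ
    isTotalOrder : IsTotalOrder _≡_ _≤_
    +-monoˡ-≤  : ∀ {x y} z → x ≤ y → x + z ≤ y + z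
    *-nonneg   : ∀ {x y} → 0ℝ ≤ x → 0ℝ ≤ y → 0ℝ ≤ x * y
    complete   : (P : ℝ → Set) → ∃ P → (∃ λ b → ∀ x → P x → x ≤ b) →
                 ∃ λ s → (∀ x → P x → x ≤ s) × (∀ b → (∀ x → P x → x ≤ b) → s ≤ b)

  _-_ : ℝ → ℝ → ℝ
  x - y = x + (- y)

  Abs≤ : ℝ → ℝ → Set
  Abs≤ x c = (x ≤ c) × (- c ≤ x)

  Σ[_] : ∀ {n} → (Fin n → ℝ) → ℝ
  Σ[_] {zero}  f = 0ℝ
  Σ[_] {suc n} f = f F.zero + Σ[ (λ i → f (F.suc i)) ]

  -- Σ_{i=1}^{z} f i + Σ_{i=z+1}^{n} g i, with z the 1-based index toℕ z + 1
  -- (the 0-based index i satisfies i+1 ≤ z+1 iff toℕ i ≤ toℕ z)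
  splitSum : ∀ {n} → Fin n → (Fin n → ℝ) → (Fin n → ℝ) → ℝ
  splitSum z f g = Σ[ (λ i → if toℕ i ≤ᵇ toℕ z then f i else g i) ]

{-# OPTIONS --safe #-}
module Submission where

-- Put d i = A i - B i ∈ [-c, c] and w k = Σ_{i≤k} d i - Σ_{i>k} d i for 0 ≤ k ≤ n; we need
-- some z ≥ 1 with |w z| ≤ c. Now w 0 = - T and w n = T for T = Σ d, and consecutive terms
-- differ by 2 d k ∈ [-2c, 2c]. If |T| ≤ c take z = n. If T ≥ c the walk starts at or below -c,
-- ends at or above -c, and a step from at or below -c lands at or below c, so the first z ≥ 1
-- with w z ≥ -c works. The case T ≤ -c is symmetric.

open import Defs
open import Level using (0ℓ)
open import Data.Nat using (ℕ; zero; suc) renaming (_≤_ to _≤ℕ_)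
open import Data.Fin using (Fin; zero; suc; fromℕ; inject₁)
open import Data.Product using (∃; _×_; _,_; proj₁; proj₂; map; swap)
open import Data.Sum using (_⊎_; inj₁; inj₂)
open import Function using (_∘_; id; flip)
open import Relation.Binary.Core using (Rel)
open import Relation.Binary.Definitions using (Total)
open import Relation.Binary.Bundles using (Poset)
open import Relation.Binary.Structures using (IsTotalOrder)
open import Relation.Binary.PropositionalEquality using (_≡_; refl; sym; cong; cong₂; subst; module ≡-Reasoning)
open import Algebra.Bundles using (CommutativeRing)
import Algebra.Properties.Group as GroupProperties
import Algebra.Properties.AbelianGroup as AbelianGroupProperties
import Algebra.Properties.CommutativeSemigroup as CommutativeSemigroupProperties
import Relation.Binary.Reasoning.PartialOrder as PosetReasoning

module _ {a ℓ} {A : Set a} {_≤_ : Rel A ℓ} (total : Total _≤_) where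

  intermediate-value : ∀ {lo hi n} (x : Fin (suc n) → A) →
                       (∀ k → x (inject₁ k) ≤ lo → x (suc k) ≤ hi) →
                       x zero ≤ hi → lo ≤ x (fromℕ n) →
                       ∃ λ k → x k ≤ hi × lo ≤ x k
  intermediate-value {n = zero} x step start end = zero , start , end
  intermediate-value {lo} {n = suc n} x step start end with total lo (x zero)
  ... | inj₁ lo≤x₀ = zero , start , lo≤x₀
  ... | inj₂ x₀≤lo = map suc id (intermediate-value (x ∘ suc) (step ∘ suc) (step zero x₀≤lo) end)

module _ (R : RealField) where
  open RealField R
  open IsTotalOrder isTotalOrder using (total; isPartialOrder) renaming (trans to ≤-trans)

  private
    commutativeRing : CommutativeRing 0ℓ 0ℓ
    commutativeRing = record { isCommutativeRing = isCommutativeRing }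

    poset : Poset 0ℓ 0ℓ 0ℓ
    poset = record { isPartialOrder = isPartialOrder }

  open CommutativeRing commutativeRing
    using (+-comm; +-assoc; +-identityˡ; +-identityʳ; -‿inverseʳ;
           +-group; +-abelianGroup; +-commutativeSemigroup)
  open GroupProperties +-group
    using (ε⁻¹≈ε; ⁻¹-involutive; ⁻¹-anti-homo-∙; \\-leftDividesˡ; \\-leftDividesʳ)
  open AbelianGroupProperties +-abelianGroup using (⁻¹-∙-comm; ⁻¹-anti-homo‿-)
  open CommutativeSemigroupProperties +-commutativeSemigroup using (interchange)
  module ≤-Reasoning = PosetReasoning poset

  +-minus-interchange : ∀ a b c d → (a + c) - (b + d) ≡ (a - b) + (c - d)
  +-minus-interchange a b c d = begin
    (a + c) - (b + d)      ≡⟨ cong ((a + c) +_) (⁻¹-∙-comm b d) ⟨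
    (a + c) + (- b + - d)  ≡⟨ interchange a c (- b) (- d) ⟩
    (a - b) + (c - d)      ∎
    where open ≡-Reasoning

  minus≡neg-sum+double : ∀ a b → a - b ≡ - (a + b) + (a + a)
  minus≡neg-sum+double a b = begin
    a + - b                  ≡⟨ +-comm a (- b) ⟩
    - b + a                  ≡⟨ cong (- b +_) (\\-leftDividesʳ a a) ⟨
    - b + (- a + (a + a))    ≡⟨ +-assoc (- b) (- a) (a + a) ⟨
    (- b + - a) + (a + a)    ≡⟨ cong (_+ (a + a)) (⁻¹-anti-homo-∙ a b) ⟨
    - (a + b) + (a + a)      ∎
    where open ≡-Reasoning

  Σ-distrib-minus : ∀ {n} (f g : Fin n → ℝ) → Σ[ (λ i → f i - g i) ] ≡ Σ[ f ] - Σ[ g ]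
  Σ-distrib-minus {zero}  f g = sym (-‿inverseʳ 0ℝ)
  Σ-distrib-minus {suc n} f g = begin
    (f zero - g zero) + Σ[ (λ i → f (suc i) - g (suc i)) ]
      ≡⟨ cong ((f zero - g zero) +_) (Σ-distrib-minus (f ∘ suc) (g ∘ suc)) ⟩
    (f zero - g zero) + (Σ[ f ∘ suc ] - Σ[ g ∘ suc ])
      ≡⟨ +-minus-interchange (f zero) (g zero) (Σ[ f ∘ suc ]) (Σ[ g ∘ suc ]) ⟨
    Σ[ f ] - Σ[ g ] ∎
    where open ≡-Reasoning

  signedSum : ∀ {n} → (Fin n → ℝ) → Fin (suc n) → ℝ
  signedSum d zero = - Σ[ d ]
  signedSum {suc n} d (suc k) = d zero + signedSum (d ∘ suc) k

  signedSum-fromℕ : ∀ {n} (d : Fin n → ℝ) → signedSum d (fromℕ n) ≡ Σ[ d ]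
  signedSum-fromℕ {zero}  d = ε⁻¹≈ε
  signedSum-fromℕ {suc n} d = cong (d zero +_) (signedSum-fromℕ (d ∘ suc))

  signedSum-suc : ∀ {n} (d : Fin n → ℝ) (k : Fin n) →
                  signedSum d (suc k) ≡ signedSum d (inject₁ k) + (d k + d k)
  signedSum-suc d zero = minus≡neg-sum+double (d zero) (Σ[ d ∘ suc ])
  signedSum-suc d (suc k) = begin
    d zero + signedSum (d ∘ suc) (suc k)
      ≡⟨ cong (d zero +_) (signedSum-suc (d ∘ suc) k) ⟩
    d zero + (signedSum (d ∘ suc) (inject₁ k) + (d (suc k) + d (suc k)))
      ≡⟨ +-assoc (d zero) _ _ ⟨
    signedSum d (inject₁ (suc k)) + (d (suc k) + d (suc k)) ∎
    where open ≡-Reasoning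

  -- Holds by refl only after matching on z: Σ[_] must unfold once before the tests
  -- toℕ i ≤ᵇ toℕ z on the two sides reduce to the same term.
  splitSum-suc : ∀ {n} (z : Fin n) (f g : Fin (suc n) → ℝ) →
                 splitSum (suc z) f g ≡ f zero + splitSum z (f ∘ suc) (g ∘ suc)
  splitSum-suc zero    f g = refl
  splitSum-suc (suc z) f g = refl

  splitSum-difference : ∀ {n} (z : Fin n) (A B : Fin n → ℝ) →
                        splitSum z A B - splitSum z B A ≡ signedSum (λ i → A i - B i) (suc z)
  splitSum-difference zero A B = begin
    (A zero + Σ[ B ∘ suc ]) - (B zero + Σ[ A ∘ suc ])
      ≡⟨ +-minus-interchange (A zero) (B zero) _ _ ⟩
    (A zero - B zero) + (Σ[ B ∘ suc ] - Σ[ A ∘ suc ])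
      ≡⟨ cong ((A zero - B zero) +_) (⁻¹-anti-homo‿- (Σ[ A ∘ suc ]) (Σ[ B ∘ suc ])) ⟨
    (A zero - B zero) + - (Σ[ A ∘ suc ] - Σ[ B ∘ suc ])
      ≡⟨ cong (λ t → (A zero - B zero) + - t) (Σ-distrib-minus (A ∘ suc) (B ∘ suc)) ⟨
    signedSum (λ i → A i - B i) (suc zero) ∎
    where open ≡-Reasoning
  splitSum-difference (suc z) A B = begin
    splitSum (suc z) A B - splitSum (suc z) B A
      ≡⟨ cong₂ _-_ (splitSum-suc z A B) (splitSum-suc z B A) ⟩
    (A zero + splitSum z (A ∘ suc) (B ∘ suc)) - (B zero + splitSum z (B ∘ suc) (A ∘ suc))
      ≡⟨ +-minus-interchange (A zero) (B zero) _ _ ⟩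
    (A zero - B zero) + (splitSum z (A ∘ suc) (B ∘ suc) - splitSum z (B ∘ suc) (A ∘ suc))
      ≡⟨ cong ((A zero - B zero) +_) (splitSum-difference z (A ∘ suc) (B ∘ suc)) ⟩
    signedSum (λ i → A i - B i) (suc (suc z)) ∎
    where open ≡-Reasoning

  +-mono-≤ : ∀ {a b c d} → a ≤ b → c ≤ d → a + c ≤ b + d
  +-mono-≤ {a} {b} {c} {d} a≤b c≤d = begin
    a + c  ≤⟨ +-monoˡ-≤ c a≤b ⟩
    b + c  ≡⟨ +-comm b c ⟩
    c + b  ≤⟨ +-monoˡ-≤ b c≤d ⟩
    d + b  ≡⟨ +-comm d b ⟩
    b + d  ∎
    where open ≤-Reasoning

  neg-mono-≤ : ∀ {a b} → a ≤ b → - b ≤ - a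
  neg-mono-≤ {a} {b} a≤b = begin
    - b                ≡⟨ \\-leftDividesˡ a (- b) ⟨
    a + (- a + - b)    ≤⟨ +-monoˡ-≤ (- a + - b) a≤b ⟩
    b + (- a + - b)    ≡⟨ cong (b +_) (+-comm (- a) (- b)) ⟩
    b + (- b + - a)    ≡⟨ \\-leftDividesˡ b (- a) ⟩
    - a                ∎
    where open ≤-Reasoning

  minus-bounded : ∀ {a b c} → (0ℝ ≤ a) × (a ≤ c) → (0ℝ ≤ b) × (b ≤ c) → Abs≤ (a - b) c
  minus-bounded {a} {b} {c} (0≤a , a≤c) (0≤b , b≤c) = upper , lower
    where
    open ≤-Reasoning
    upper : a - b ≤ c
    upper = begin
      a + - b    ≤⟨ +-mono-≤ a≤c (neg-mono-≤ 0≤b) ⟩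
      c + - 0ℝ   ≡⟨ cong (c +_) ε⁻¹≈ε ⟩
      c + 0ℝ     ≡⟨ +-identityʳ c ⟩
      c          ∎
    lower : - c ≤ a - b
    lower = begin
      - c        ≡⟨ +-identityˡ (- c) ⟨
      0ℝ + - c   ≤⟨ +-mono-≤ 0≤a (neg-mono-≤ b≤c) ⟩
      a + - b    ∎

  jump-up : ∀ {x d c} → x ≤ - c → d ≤ c → x + (d + d) ≤ c
  jump-up {x} {d} {c} x≤-c d≤c = begin
    x + (d + d)      ≤⟨ +-mono-≤ x≤-c (+-mono-≤ d≤c d≤c) ⟩
    - c + (c + c)    ≡⟨ \\-leftDividesʳ c c ⟩
    c                ∎
    where open ≤-Reasoning

  jump-down : ∀ {x d c} → c ≤ x → - c ≤ d → - c ≤ x + (d + d)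
  jump-down {x} {d} {c} c≤x -c≤d = begin
    - c                ≡⟨ \\-leftDividesˡ c (- c) ⟨
    c + (- c + - c)    ≤⟨ +-mono-≤ c≤x (+-mono-≤ -c≤d -c≤d) ⟩
    x + (d + d)        ∎
    where open ≤-Reasoning

  signedSum-step-up : ∀ {n c} (d : Fin n → ℝ) → (∀ i → Abs≤ (d i) c) →
                      ∀ k → signedSum d (inject₁ k) ≤ - c → signedSum d (suc k) ≤ c
  signedSum-step-up {c = c} d bounded k w≤-c =
    subst (_≤ c) (sym (signedSum-suc d k)) (jump-up w≤-c (proj₁ (bounded k)))

  signedSum-step-down : ∀ {n c} (d : Fin n → ℝ) → (∀ i → Abs≤ (d i) c) →
                        ∀ k → c ≤ signedSum d (inject₁ k) → - c ≤ signedSum d (suc k)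
  signedSum-step-down {c = c} d bounded k c≤w =
    subst (- c ≤_) (sym (signedSum-suc d k)) (jump-down c≤w (proj₂ (bounded k)))

  signedSum-crossing : ∀ {n c} (d : Fin (suc n) → ℝ) → (∀ i → Abs≤ (d i) c) →
                       ∃ λ z → Abs≤ (signedSum d (suc z)) c
  signedSum-crossing {n} {c} d bounded = cases (total c (Σ[ d ])) (total (Σ[ d ]) (- c))
    where
    open ≤-Reasoning
    up : ∀ k → signedSum d (inject₁ k) ≤ - c → signedSum d (suc k) ≤ c
    up = signedSum-step-up d bounded

    down : ∀ k → c ≤ signedSum d (inject₁ k) → - c ≤ signedSum d (suc k)
    down = signedSum-step-down d bounded

    last : signedSum d (fromℕ (suc n)) ≡ Σ[ d ]
    last = signedSum-fromℕ d

    -c≤c : - c ≤ c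
    -c≤c = ≤-trans (proj₂ (bounded zero)) (proj₁ (bounded zero))

    cases : c ≤ Σ[ d ] ⊎ Σ[ d ] ≤ c → Σ[ d ] ≤ - c ⊎ - c ≤ Σ[ d ] →
            ∃ λ z → Abs≤ (signedSum d (suc z)) c
    cases (inj₁ c≤Σ) _ =
      intermediate-value total (signedSum d ∘ suc) (up ∘ suc) (up zero (neg-mono-≤ c≤Σ)) (begin
        - c                          ≤⟨ -c≤c ⟩
        c                            ≤⟨ c≤Σ ⟩
        Σ[ d ]                       ≡⟨ last ⟨
        signedSum d (fromℕ (suc n))  ∎)
    cases (inj₂ Σ≤c) (inj₁ Σ≤-c) = map id swap
      (intermediate-value (flip total) (signedSum d ∘ suc) (down ∘ suc) (down zero c≤-Σ) (begin
        signedSum d (fromℕ (suc n))  ≡⟨ last ⟩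
        Σ[ d ]                       ≤⟨ Σ≤-c ⟩
        - c                          ≤⟨ -c≤c ⟩
        c                            ∎))
      where
      c≤-Σ : c ≤ - Σ[ d ]
      c≤-Σ = subst (_≤ - Σ[ d ]) (⁻¹-involutive c) (neg-mono-≤ Σ≤-c)
    cases (inj₂ Σ≤c) (inj₂ -c≤Σ) = fromℕ n , subst (λ t → Abs≤ t c) (sym last) (Σ≤c , -c≤Σ)

lemma3 : (R : RealField) → let open RealField R in
    (n : ℕ) → 1 ≤ℕ n → (c : ℝ) → (A B : Fin n → ℝ) →
    (∀ i → (0ℝ ≤ A i) × (A i ≤ c)) → (∀ i → (0ℝ ≤ B i) × (B i ≤ c)) →
    ∃ λ (z : Fin n) → Abs≤ (splitSum z A B - splitSum z B A) c
lemma3 R zero () c A B hA hB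
lemma3 R (suc n) _ c A B hA hB =
  let z , bounded = signedSum-crossing R (λ i → A i - B i) (λ i → minus-bounded R (hA i) (hB i))
  in  z , subst (λ t → Abs≤ t c) (sym (splitSum-difference R z A B)) bounded
  where open RealField R
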